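{- Let $\Pi$ be a hierarchical partition system on $X$. Then $\Pi$ is compatible. Moreover, $\mathcal{T}_\Pi$ is isomorphic to $\mathcal{T}^-_\rho$, where $\mathcal{T}_\rho$ is the (up to isomorphism unique) rooted weak $X$-tree with $\mathcal{H}(\mathcal{T}_\rho)=\biguplus_{\pi\in\Pi}\pi$.
   Context: $X$ is a finite set with $|X|\ge 2$. A partition of $X$ is a set of $t\ge 2$ pairwise disjoint non-empty subsets (parts) whose union is $X$; an $X$-split is a partition with two parts, written $A|(X-A)$. A partition system is a finite multiset of partitions of $X$; $\Sigma_\Pi=\biguplus_{\pi\in\Pi}\biguplus_{A\in\pi}\{A|(X-A)\}$ (multiset union). A split multiset is compatible if for any two of its splits $A_1|B_1,A_2|B_2$ one of $A_1\cap A_2,A_1\cap B_2,B_1\cap A_2,B_1\cap B_2$ is empty; $\Pi$ is compatible if $\Sigma_\Pi$ is compatible. $\Pi$ is hierarchical if the set of all parts of all partitions in $\Pi$ is a hierarchy ($A\cap B\in\{\emptyset,A,B\}$ for any two parts). A weak $X$-tree $(T;\phi)$ is a tree $T$ with $\phi:X\to V(T)$ such that every leaf lies in $\phi(X)$; each edge $e$ gives the split $\sigma_e=\phi^{ -1}(W)|(X-\phi^{ -1}(W))$, $W$ a component of $T-e$, and $\Sigma(\mathcal{T})=\biguplus_e\{\sigma_e\}$. Two weak $X$-trees $(T;\phi),(T';\phi')$ are isomorphic if there is a graph isomorphism $\psi:T\to T'$ with $\phi'=\psi\circ\phi$. For a compatible $\Pi$, $\mathcal{T}_\Pi$ denotes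 the weak $X$-tree, unique up to isomorphism, with $\Sigma(\mathcal{T}_\Pi)=\Sigma_\Pi$. A rooted weak $X$-tree $(T_\rho;\phi)$ is a tree $T_\rho$ with a root $\rho$ of degree at least two and a map $\phi:X\to V(T_\rho)-\{\rho\}$ such that every leaf lies in $\phi(X)$; $\mathcal{T}^-_\rho$ denotes the same object viewed as an (unrooted) weak $X$-tree. For an edge $e$, the cluster $C_e$ is the set of $x\in X$ whose vertex $\phi(x)$ has its path to $\rho$ traversing $e$, and $\mathcal{H}(\mathcal{T}_\rho)=\biguplus_e\{C_e\}$. A multiset of proper non-empty subsets of $X$ with union $X$ equals $\mathcal{H}(\mathcal{T}_\rho)$ for some rooted weak $X$-tree, unique up to isomorphism, iff it is a hierarchy; $\biguplus_{\pi\in\Pi}\pi$ denotes the multiset of all parts of partitions of $\Pi$, counted with multiplicity. -}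

module Defs where

open import Data.Nat using (ℕ; zero; suc; _+_; _≤_)
open import Data.Fin using (Fin; _≟_)
open import Data.Fin.Subset using (Subset; _∈_; _∉_; _∩_; ∁; Nonempty; Empty)
open import Data.Bool using (if_then_else_)
open import Data.List using (List; length; concatMap; lookup; map; allFin)
open import Data.Nat.ListAction using (sum)
open import Data.List.Relation.Unary.All using (All)
open import Data.List.Relation.Unary.Any using (Any)
open import Data.List.Relation.Unary.AllPairs using (AllPairs)
open import Data.Product using (_×_; _,_; proj₁; proj₂; ∃; Σ-syntax)
open import Data.Sum using (_⊎_)
open import Function.Bundles using (_↔_; _⇔_; Inverse)
open import Relation.Binary.PropositionalEquality using (_≡_; _≢_)
open import Relation.Nullary using (¬_)
open import Relation.Nullary.Decidable using (⌊_⌋)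

-- The ground set X is Fin n (any finite set is in bijection with some Fin n).
-- Subsets of X are Data.Fin.Subset n.

Disjoint : ∀ {n} → Subset n → Subset n → Set
Disjoint A B = Empty (A ∩ B)

-- The parts are listed; since they are non-empty and
-- pairwise disjoint (at distinct list positions), the list has no
-- repetitions, so it represents a set.
record Partition (n : ℕ) : Set where
  field
    parts    : List (Subset n)
    atLeast2 : 2 ≤ length parts
    nonempty : All Nonempty parts
    disjoint : AllPairs Disjoint parts
    covers   : ∀ (x : Fin n) → Any (x ∈_) parts
open Partition public

-- A partition system: a finite multiset (here a list) of partitions.
PartitionSystem : ℕ → Set
PartitionSystem n = List (Partition n)

allParts : ∀ {n} → PartitionSystem n → List (Subset n)
allParts Π = concatMap parts Π

-- Σ_Π : the multiset of splits A|(X-A), A ranging over allParts Π.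
-- A split A|(X-A) is represented by the subset A; the element of Σ_Π
-- at position i is the split  lookup (allParts Π) i | complement.

CompatibleSplits : ∀ {n} → Subset n → Subset n → Set
CompatibleSplits A₁ A₂ =
  Empty (A₁ ∩ A₂) ⊎ Empty (A₁ ∩ ∁ A₂) ⊎ Empty (∁ A₁ ∩ A₂) ⊎ Empty (∁ A₁ ∩ ∁ A₂)

Compatible : ∀ {n} → PartitionSystem n → Set
Compatible Π = AllPairs CompatibleSplits (allParts Π)

Nested : ∀ {n} → Subset n → Subset n → Set
Nested A B = Empty (A ∩ B) ⊎ (A ∩ B ≡ A) ⊎ (A ∩ B ≡ B)

Hierarchical : ∀ {n} → PartitionSystem n → Set
Hierarchical Π = AllPairs Nested (allParts Π)

Edges : ℕ → ℕ → Set
Edges m k = Fin k → Fin m × Fin m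

data Reach {m k : ℕ} (E : Edges m k) (allowed : Fin k → Set)
           : Fin m → Fin m → Set where
  here  : ∀ {u} → Reach E allowed u u
  fwd   : ∀ {u v} (j : Fin k) → allowed j → proj₁ (E j) ≡ u →
          Reach E allowed (proj₂ (E j)) v → Reach E allowed u v
  bwd   : ∀ {u v} (j : Fin k) → allowed j → proj₂ (E j) ≡ u →
          Reach E allowed (proj₁ (E j)) v → Reach E allowed u v

AnyEdge : ∀ {k} → Fin k → Set
AnyEdge _ = Fin 1

NotEdge : ∀ {k} → Fin k → Fin k → Set
NotEdge e j = j ≢ e

-- degree of a vertex (a loop counts twice)
degree : ∀ {m k} → Edges m k → Fin m → ℕ
degree {k = k} E v =
  sum (map (λ j → (if ⌊ proj₁ (E j) ≟ v ⌋ then 1 else 0)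
                + (if ⌊ proj₂ (E j) ≟ v ⌋ then 1 else 0)) (allFin k))

Adjacent : ∀ {m k} → Edges m k → Fin m → Fin m → Set
Adjacent E u v = ∃ λ j → (E j ≡ (u , v)) ⊎ (E j ≡ (v , u))

-- A weak X-tree (T;φ): T a tree (connected, with |E| = |V| - 1),
-- φ : X → V(T), every leaf (vertex of degree 1) lies in φ(X).
record WeakXTree (n : ℕ) : Set where
  field
    #V        : ℕ
    #E        : ℕ
    edge      : Edges #V #E
    connected : ∀ u v → Reach edge AnyEdge u v
    edgeCount : #E + 1 ≡ #V
    φ         : Fin n → Fin #V
    leavesLabelled : ∀ v → degree edge v ≡ 1 → ∃ λ x → φ x ≡ v
open WeakXTree public

-- σ_e = φ⁻¹(W) | X - φ⁻¹(W), W the component of T - e containing the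
-- first endpoint of e.  Side W is given as a predicate on X.
splitSide : ∀ {n} (T : WeakXTree n) → Fin (#E T) → Fin n → Set
splitSide T e x = Reach (edge T) (NotEdge e) (proj₁ (edge T e)) (φ T x)

SplitEq : ∀ {n} → (Fin n → Set) → Subset n → Set
SplitEq {n} W A = (∀ x → W x ⇔ (x ∈ A)) ⊎ (∀ x → W x ⇔ (x ∉ A))

-- Σ(T) = Σ_Π as multisets: a bijection between the edges of T and the
-- positions of Σ_Π matching the splits.
HasSplits : ∀ {n} → WeakXTree n → PartitionSystem n → Set
HasSplits T Π =
  Σ[ β ∈ (Fin (#E T) ↔ Fin (length (allParts Π))) ]
    (∀ e → SplitEq (splitSide T e) (lookup (allParts Π) (Inverse.to β e)))

Isomorphic : ∀ {n} → WeakXTree n → WeakXTree n → Set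
Isomorphic T T' =
  Σ[ ψ ∈ (Fin (#V T) ↔ Fin (#V T')) ]
    ((∀ u v → Adjacent (edge T) u v ⇔
               Adjacent (edge T') (Inverse.to ψ u) (Inverse.to ψ v))
     × (∀ x → φ T' x ≡ Inverse.to ψ (φ T x)))

record RootedWeakXTree (n : ℕ) : Set where
  field
    unrooted   : WeakXTree n      -- this is 𝒯⁻_ρ
    root       : Fin (#V unrooted)
    rootDegree : 2 ≤ degree (edge unrooted) root
    avoidsRoot : ∀ x → φ unrooted x ≢ root
open RootedWeakXTree public

-- C_e : x ∈ C_e iff the path from φ(x) to ρ traverses e, i.e. iff
-- φ(x) and ρ lie in different components of T - e.
cluster : ∀ {n} (T : RootedWeakXTree n) → Fin (#E (unrooted T)) → Fin n → Set
cluster T e x =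
  ¬ Reach (edge (unrooted T)) (NotEdge e) (φ (unrooted T) x) (root T)

HasClusters : ∀ {n} → RootedWeakXTree n → PartitionSystem n → Set
HasClusters T Π =
  Σ[ β ∈ (Fin (#E (unrooted T)) ↔ Fin (length (allParts Π))) ]
    (∀ e → ∀ x → cluster T e x ⇔ (x ∈ lookup (allParts Π) (Inverse.to β e)))

module Submission where

-- Compatibility holds because nested sets give compatible splits.  For the
-- isomorphism, both trees display the same multiset of splits: 𝒯_Π by
-- definition, and 𝒯⁻ρ because each cluster C_e is the side of σ_e away
-- from the root.  These splits are non-trivial (a part of a partition with
-- at least two parts misses another part), so the claim is an instance of
-- the uniqueness half of the Splits-Equivalence Theorem, proved here by a
-- signature argument.  The profile of a vertex v counts, for each B ⊆ X,
-- the edges whose side containing v has label set B.  Profiles of labelled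
-- vertices depend only on the splits; distinct vertices have distinct
-- profiles; the edges at v are recognised from the profile of v as its
-- minimal entries, and crossing one changes the profile predictably.  So
-- walks copy from one tree to the other, and equal profile is the
-- isomorphism.

open import Defs
open import Data.Nat using (ℕ; zero; suc; _+_; _≤_; _<_; z≤n; s≤s)
open import Data.Nat.Properties
  using (≤-refl; <-irrefl; <-asym; +-mono-≤; +-comm; +-assoc; +-cancelʳ-≡; m<m+n; +-0-commutativeMonoid)
open import Data.Bool using (true)
import Data.Bool as Bool
open import Data.Fin using (Fin; zero; suc; toℕ; punchIn)
import Data.Fin as Fin
open import Data.Fin.Properties using (any?; pigeonhole; punchInᵢ≢i)
open import Data.Fin.Subset using (Subset; _∈_; _∉_; _⊆_; ∁; Nonempty)
open import Data.Fin.Subset.Properties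
  using (_∈?_; ⊆-antisym; x∈∁p⇒x∉p; x∉p⇒x∈∁p; x∉∁p⇒x∈p; x∈p⇒x∉∁p; x∈p∩q⁺; x∈p∩q⁻)
open import Data.Vec using (tabulate)
open import Data.Vec.Properties using (lookup∘tabulate; []=⇒lookup; lookup⇒[]=; ≡-dec)
open import Data.List using (List; []; _∷_; length)
import Data.List as List
open import Data.List.Membership.Propositional.Properties using (∈-lookup)
open import Data.List.Relation.Unary.All using (All; []; _∷_)
import Data.List.Relation.Unary.All as All
open import Data.List.Relation.Unary.All.Properties using (++⁺)
open import Data.List.Relation.Unary.AllPairs using (AllPairs; []; _∷_)
import Data.List.Relation.Unary.AllPairs as AllPairs
open import Data.Product using (_×_; _,_; proj₁; proj₂; ∃; Σ; map₂)
open import Data.Sum using (_⊎_; inj₁; inj₂; [_,_]′)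
open import Data.Empty using (⊥-elim)
open import Function using (_∘_; id)
open import Function.Bundles using (_↔_; _⇔_; Inverse; Equivalence; mk⇔; mk↔ₛ′)
open import Relation.Nullary using (¬_; Dec; yes; no)
open import Relation.Nullary.Decidable using (⌊_⌋; _⊎-dec_; _×-dec_; ¬?)
open import Relation.Binary.PropositionalEquality
  using (_≡_; _≢_; refl; sym; trans; cong; cong₂; subst; subst₂; module ≡-Reasoning)
import Algebra.Properties.CommutativeMonoid.Sum as MonoidSum

_≟ˢ_ : ∀ {n} (A B : Subset n) → Dec (A ≡ B)
_≟ˢ_ = ≡-dec Bool._≟_

subset-ext : ∀ {n} {A B : Subset n} → (∀ x → x ∈ A ⇔ x ∈ B) → A ≡ B
subset-ext same = ⊆-antisym (Equivalence.to (same _)) (Equivalence.from (same _))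

∁-involutive : ∀ {n} (A : Subset n) → ∁ (∁ A) ≡ A
∁-involutive A = subset-ext λ x → mk⇔ (x∉∁p⇒x∈p ∘ x∈∁p⇒x∉p) (x∉p⇒x∈∁p ∘ x∈p⇒x∉∁p)

subsetOf : ∀ {n} {P : Fin n → Set} → (∀ x → Dec (P x)) → Subset n
subsetOf P? = tabulate (λ x → ⌊ P? x ⌋)

∈-subsetOf : ∀ {n} {P : Fin n → Set} (P? : ∀ x → Dec (P x)) {x : Fin n} →
             x ∈ subsetOf P? ⇔ P x
∈-subsetOf P? {x} = mk⇔ (decided (P? x) ∘ entryIn) (entryOut ∘ chosen (P? x))
  where
  entryIn : x ∈ subsetOf P? → ⌊ P? x ⌋ ≡ true
  entryIn x∈ = trans (sym (lookup∘tabulate _ x)) ([]=⇒lookup x∈)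
  entryOut : ⌊ P? x ⌋ ≡ true → x ∈ subsetOf P?
  entryOut eq = lookup⇒[]= x _ (trans (lookup∘tabulate _ x) eq)
  decided : ∀ {Q : Set} (d : Dec Q) → ⌊ d ⌋ ≡ true → Q
  decided (yes q) _ = q
  decided (no _) ()
  chosen : ∀ {Q : Set} (d : Dec Q) → Q → ⌊ d ⌋ ≡ true
  chosen (yes _) _ = refl
  chosen (no ¬q) q = ⊥-elim (¬q q)

IsSideOf : ∀ {n} → Subset n → Subset n → Set
IsSideOf C A = C ≡ A ⊎ C ≡ ∁ A

∁-side : ∀ {n} {A C : Subset n} → IsSideOf C A → IsSideOf (∁ C) A
∁-side (inj₁ refl) = inj₂ refl
∁-side {A = A} (inj₂ refl) = inj₁ (∁-involutive A)

sideOf : ∀ {n} → Fin n → Subset n → Subset n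
sideOf x A with x ∈? A
... | yes _ = A
... | no _ = ∁ A

sideOf-unique : ∀ {n} {x : Fin n} {A C : Subset n} → IsSideOf C A → x ∈ C → C ≡ sideOf x A
sideOf-unique {x = x} {A} C-side x∈C with x ∈? A | C-side
... | yes _   | inj₁ C≡A  = C≡A
... | yes x∈A | inj₂ refl = ⊥-elim (x∈∁p⇒x∉p x∈C x∈A)
... | no x∉A  | inj₁ refl = ⊥-elim (x∉A x∈C)
... | no _    | inj₂ C≡∁A = C≡∁A

module Sum = MonoidSum +-0-commutativeMonoid

[_] : ∀ {P : Set} → Dec P → ℕ
[ yes _ ] = 1
[ no _ ] = 0

[]-cong : ∀ {P Q : Set} → (P ⇔ Q) → (p : Dec P) (q : Dec Q) → [ p ] ≡ [ q ]
[]-cong P⇔Q (yes _) (yes _) = refl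
[]-cong P⇔Q (yes p) (no ¬q) = ⊥-elim (¬q (Equivalence.to P⇔Q p))
[]-cong P⇔Q (no ¬p) (yes q) = ⊥-elim (¬p (Equivalence.from P⇔Q q))
[]-cong P⇔Q (no _) (no _) = refl

[]-mono : ∀ {P Q : Set} → (P → Q) → (p : Dec P) (q : Dec Q) → [ p ] ≤ [ q ]
[]-mono P→Q (yes p) (no ¬q) = ⊥-elim (¬q (P→Q p))
[]-mono P→Q (yes _) (yes _) = ≤-refl
[]-mono P→Q (no _) _ = z≤n

count : ∀ {k} {P : Fin k → Set} → (∀ i → Dec (P i)) → ℕ
count P? = Sum.sum (λ i → [ P? i ])

count-cong : ∀ {k} {P Q : Fin k → Set} (P? : ∀ i → Dec (P i)) (Q? : ∀ i → Dec (Q i)) →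
             (∀ i → P i ⇔ Q i) → count P? ≡ count Q?
count-cong P? Q? P⇔Q = Sum.sum-cong-≗ (λ i → []-cong (P⇔Q i) (P? i) (Q? i))

count-mono : ∀ {k} {P Q : Fin k → Set} (P? : ∀ i → Dec (P i)) (Q? : ∀ i → Dec (Q i)) →
             (∀ i → P i → Q i) → count P? ≤ count Q?
count-mono {zero} P? Q? P⇒Q = z≤n
count-mono {suc k} P? Q? P⇒Q =
  +-mono-≤ ([]-mono (P⇒Q zero) (P? zero) (Q? zero)) (count-mono (P? ∘ suc) (Q? ∘ suc) (P⇒Q ∘ suc))

count-remove : ∀ {k} {P : Fin (suc k) → Set} (P? : ∀ i → Dec (P i)) (e : Fin (suc k)) →
               count P? ≡ [ P? e ] + count (P? ∘ punchIn e)
count-remove P? e = Sum.sum-remove {i = e} (λ i → [ P? i ])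

count-pos : ∀ {k} {P : Fin k → Set} (P? : ∀ i → Dec (P i)) (e : Fin k) → P e → 1 ≤ count P?
count-pos {suc k} P? e p rewrite count-remove P? e with P? e
... | yes _ = s≤s z≤n
... | no ¬p = ⊥-elim (¬p p)

count-strict : ∀ {k} {P Q : Fin k → Set} (P? : ∀ i → Dec (P i)) (Q? : ∀ i → Dec (Q i)) →
               (∀ i → P i → Q i) → (e : Fin k) → ¬ P e → Q e → count P? < count Q?
count-strict {suc k} P? Q? P⇒Q e ¬p q
  rewrite count-remove P? e | count-remove Q? e with P? e | Q? e
... | yes p | _ = ⊥-elim (¬p p)
... | no _ | no ¬q = ⊥-elim (¬q q)
... | no _ | yes _ = s≤s (count-mono (P? ∘ punchIn e) (Q? ∘ punchIn e) (P⇒Q ∘ punchIn e))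

count-witness : ∀ {k} {P : Fin k → Set} (P? : ∀ i → Dec (P i)) → 1 ≤ count P? → ∃ P
count-witness {suc k} P? pos with P? zero
... | yes p = zero , p
... | no _ with count-witness (P? ∘ suc) pos
...   | i , p = suc i , p

count-none : ∀ {k} {P : Fin k → Set} (P? : ∀ i → Dec (P i)) → (∀ i → ¬ P i) → count P? ≡ 0
count-none {zero} P? none = refl
count-none {suc k} P? none with P? zero
... | yes p = ⊥-elim (none zero p)
... | no _ = count-none (P? ∘ suc) (none ∘ suc)

count-swap : ∀ {k} {P Q : Fin k → Set} (P? : ∀ i → Dec (P i)) (Q? : ∀ i → Dec (Q i)) (e : Fin k) →
             (∀ i → i ≢ e → P i ⇔ Q i) → count P? + [ Q? e ] ≡ count Q? + [ P? e ]
count-swap {suc k} P? Q? e agree = begin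
  count P? + [ Q? e ]                             ≡⟨ cong (_+ [ Q? e ]) (count-remove P? e) ⟩
  [ P? e ] + rest P? + [ Q? e ]                   ≡⟨ cong (λ r → [ P? e ] + r + [ Q? e ]) rest-equal ⟩
  [ P? e ] + rest Q? + [ Q? e ]                   ≡⟨ +-comm ([ P? e ] + rest Q?) [ Q? e ] ⟩
  [ Q? e ] + ([ P? e ] + rest Q?)                 ≡⟨ cong ([ Q? e ] +_) (+-comm [ P? e ] (rest Q?)) ⟩
  [ Q? e ] + (rest Q? + [ P? e ])                 ≡⟨ sym (+-assoc [ Q? e ] (rest Q?) [ P? e ]) ⟩
  [ Q? e ] + rest Q? + [ P? e ]                   ≡⟨ cong (_+ [ P? e ]) (sym (count-remove Q? e)) ⟩
  count Q? + [ P? e ]                             ∎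
  where
  open ≡-Reasoning
  rest : ∀ {R : Fin (suc k) → Set} → (∀ i → Dec (R i)) → ℕ
  rest R? = count (R? ∘ punchIn e)
  rest-equal : rest P? ≡ rest Q?
  rest-equal = count-cong (P? ∘ punchIn e) (Q? ∘ punchIn e) (λ j → agree (punchIn e j) (punchInᵢ≢i e j))

count-permute : ∀ {k K} {P : Fin K → Set} (P? : ∀ i → Dec (P i)) (β : Fin k ↔ Fin K) →
                count (P? ∘ Inverse.to β) ≡ count P?
count-permute P? β = sym (Sum.sum-permute (λ i → [ P? i ]) β)

Joins : ∀ {m k} → Edges m k → Fin k → Fin m → Fin m → Set
Joins E j u v = E j ≡ (u , v) ⊎ E j ≡ (v , u)

module Walk {m k : ℕ} (E : Edges m k) where

  src tgt : Fin k → Fin m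
  src j = proj₁ (E j)
  tgt j = proj₂ (E j)

  weaken : ∀ {A B : Fin k → Set} → (∀ j → A j → B j) → ∀ {u v} → Reach E A u v → Reach E B u v
  weaken A⇒B here = here
  weaken A⇒B (fwd j a eq r) = fwd j (A⇒B j a) eq (weaken A⇒B r)
  weaken A⇒B (bwd j a eq r) = bwd j (A⇒B j a) eq (weaken A⇒B r)

  infixr 5 _▷_
  _▷_ : ∀ {A : Fin k → Set} {u v w} → Reach E A u v → Reach E A v w → Reach E A u w
  here ▷ s = s
  fwd j a eq r ▷ s = fwd j a eq (r ▷ s)
  bwd j a eq r ▷ s = bwd j a eq (r ▷ s)

  along : ∀ {A : Fin k → Set} j → A j → Reach E A (src j) (tgt j)
  along j a = fwd j a refl here

  against : ∀ {A : Fin k → Set} j → A j → Reach E A (tgt j) (src j)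
  against j a = bwd j a refl here

  reverse : ∀ {A : Fin k → Set} {u v} → Reach E A u v → Reach E A v u
  reverse here = here
  reverse (fwd j a refl r) = reverse r ▷ against j a
  reverse (bwd j a refl r) = reverse r ▷ along j a

  joins-walk : ∀ {A : Fin k → Set} {j u v} → Joins E j u v → A j → Reach E A u v
  joins-walk {j = j} (inj₁ refl) a = along j a
  joins-walk {j = j} (inj₂ refl) a = against j a

  module _ (e : Fin k) {A B : Fin k → Set} (A⇒B : ∀ j → A j → j ≢ e → B j) where

    NearEdge : Fin m → Set
    NearEdge u = Reach E B u (src e) ⊎ Reach E B u (tgt e)

    nearBefore : ∀ {u′ u} → Reach E B u′ u → NearEdge u → NearEdge u′
    nearBefore step = [ inj₁ ∘ (step ▷_) , inj₂ ∘ (step ▷_) ]′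

    avoidOrCross : ∀ {u v} → Reach E A u v → Reach E B u v ⊎ (NearEdge u × NearEdge v)
    avoidOrCross here = inj₁ here
    avoidOrCross (fwd j a refl r) with j Fin.≟ e | avoidOrCross r
    ... | yes refl | inj₁ r′ = inj₂ (inj₁ here , inj₂ (reverse r′))
    ... | yes refl | inj₂ (_ , nv) = inj₂ (inj₁ here , nv)
    ... | no j≢e | inj₁ r′ = inj₁ (fwd j (A⇒B j a j≢e) refl r′)
    ... | no j≢e | inj₂ (nu , nv) = inj₂ (nearBefore (along j (A⇒B j a j≢e)) nu , nv)
    avoidOrCross (bwd j a refl r) with j Fin.≟ e | avoidOrCross r
    ... | yes refl | inj₁ r′ = inj₂ (inj₂ here , inj₁ (reverse r′))
    ... | yes refl | inj₂ (_ , nv) = inj₂ (inj₂ here , nv)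
    ... | no j≢e | inj₁ r′ = inj₁ (bwd j (A⇒B j a j≢e) refl r′)
    ... | no j≢e | inj₂ (nu , nv) = inj₂ (nearBefore (against j (A⇒B j a j≢e)) nu , nv)

-- A connected graph on m vertices has at least m - 1 edges

leastWitness : (P : ℕ → Set) → (∀ L → Dec (P L)) → ∀ ℓ → P ℓ →
               Σ ℕ λ L → P L × (∀ L′ → P L′ → L ≤ L′)
leastWitness P P? ℓ p with P? 0
... | yes p₀ = 0 , p₀ , λ _ _ → z≤n
leastWitness P P? zero p | no ¬p₀ = ⊥-elim (¬p₀ p)
leastWitness P P? (suc ℓ) p | no ¬p₀ with leastWitness (P ∘ suc) (P? ∘ suc) ℓ p
... | L , pL , least = suc L , pL , λ { zero p₀ → ⊥-elim (¬p₀ p₀) ; (suc L′) pL′ → s≤s (least L′ pL′) }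

-- Suppose that after deleting the edge e every vertex is still connected
-- to r.  Choosing for each vertex u ≠ r an edge (≠ e) towards a vertex
-- strictly closer to r, and e for r itself, gives an injection from the
-- vertices into the edges.  Hence there cannot be exactly m - 1 edges.
module StillConnected {m k : ℕ} (E : Edges m k) (e : Fin k) (r : Fin m)
                      (conn : ∀ v → Reach E (NotEdge e) v r) where
  open Walk E

  WithinSteps : ℕ → Fin m → Set
  WithinSteps zero u = u ≡ r
  WithinSteps (suc L) u = u ≡ r ⊎ Σ (Fin k) λ j → j ≢ e ×
    ((src j ≡ u × WithinSteps L (tgt j)) ⊎ (tgt j ≡ u × WithinSteps L (src j)))

  withinSteps? : ∀ L u → Dec (WithinSteps L u)
  withinSteps? zero u = u Fin.≟ r
  withinSteps? (suc L) u =
    (u Fin.≟ r) ⊎-dec any? λ j →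
      ¬? (j Fin.≟ e) ×-dec
        (((src j Fin.≟ u) ×-dec withinSteps? L (tgt j))
         ⊎-dec
         ((tgt j Fin.≟ u) ×-dec withinSteps? L (src j)))

  walkSteps : ∀ {u} → Reach E (NotEdge e) u r → Σ ℕ λ L → WithinSteps L u
  walkSteps here = zero , refl
  walkSteps (fwd j j≢e eq r′) = let (L , w) = walkSteps r′ in suc L , inj₂ (j , j≢e , inj₁ (eq , w))
  walkSteps (bwd j j≢e eq r′) = let (L , w) = walkSteps r′ in suc L , inj₂ (j , j≢e , inj₂ (eq , w))

  shortest : ∀ u → Σ ℕ λ L → WithinSteps L u × (∀ L′ → WithinSteps L′ u → L ≤ L′)
  shortest u = leastWitness (λ L → WithinSteps L u) (λ L → withinSteps? L u) _ (proj₂ (walkSteps (conn u)))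

  dist : Fin m → ℕ
  dist u = proj₁ (shortest u)

  dist-least : ∀ L u → WithinSteps L u → dist u ≤ L
  dist-least L u w = proj₂ (proj₂ (shortest u)) L w

  StepDown : Fin m → ℕ → Set
  StepDown u L = Σ (Fin k) λ j → j ≢ e ×
    ((src j ≡ u × dist (tgt j) < L) ⊎ (tgt j ≡ u × dist (src j) < L))

  stepDown : ∀ L u → WithinSteps L u → u ≢ r → StepDown u L
  stepDown zero u u≡r u≢r = ⊥-elim (u≢r u≡r)
  stepDown (suc L) u (inj₁ u≡r) u≢r = ⊥-elim (u≢r u≡r)
  stepDown (suc L) u (inj₂ (j , j≢e , inj₁ (eq , w))) _ = j , j≢e , inj₁ (eq , s≤s (dist-least L _ w))
  stepDown (suc L) u (inj₂ (j , j≢e , inj₂ (eq , w))) _ = j , j≢e , inj₂ (eq , s≤s (dist-least L _ w))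

  descend : ∀ u → u ≢ r → StepDown u (dist u)
  descend u = stepDown (dist u) u (proj₁ (proj₂ (shortest u)))

  parent : Fin m → Fin k
  parent u with u Fin.≟ r
  ... | yes _ = e
  ... | no u≢r = proj₁ (descend u u≢r)

  -- An edge cannot lead strictly downwards from both of its endpoints.
  stepDown-injective : ∀ u v (du : StepDown u (dist u)) (dv : StepDown v (dist v)) →
                       proj₁ du ≡ proj₁ dv → u ≡ v
  stepDown-injective u v (j , _ , inj₁ (eu , _)) (.j , _ , inj₁ (ev , _)) refl = trans (sym eu) ev
  stepDown-injective u v (j , _ , inj₂ (eu , _)) (.j , _ , inj₂ (ev , _)) refl = trans (sym eu) ev
  stepDown-injective u v (j , _ , inj₁ (refl , lu)) (.j , _ , inj₂ (refl , lv)) refl = ⊥-elim (<-asym lu lv)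
  stepDown-injective u v (j , _ , inj₂ (refl , lu)) (.j , _ , inj₁ (refl , lv)) refl = ⊥-elim (<-asym lu lv)

  parent-injective : ∀ u v → parent u ≡ parent v → u ≡ v
  parent-injective u v eq with u Fin.≟ r | v Fin.≟ r
  ... | yes u≡r | yes v≡r = trans u≡r (sym v≡r)
  ... | yes _ | no v≢r = ⊥-elim (proj₁ (proj₂ (descend v v≢r)) (sym eq))
  ... | no u≢r | yes _ = ⊥-elim (proj₁ (proj₂ (descend u u≢r)) eq)
  ... | no u≢r | no v≢r = stepDown-injective u v (descend u u≢r) (descend v v≢r) eq

  notTree : k + 1 ≢ m
  notTree refl with pigeonhole (m<m+n k (s≤s z≤n)) parent
  ... | i , j , i<j , same = <-irrefl (cong toℕ (parent-injective i j same)) i<j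

module TreeGeometry {n : ℕ} (T : WeakXTree n) where

  open Walk (edge T) public

  Vertex Edge : Set
  Vertex = Fin (#V T)
  Edge = Fin (#E T)

  Conn : Edge → Vertex → Vertex → Set
  Conn e = Reach (edge T) (NotEdge e)

  toEndpoint : ∀ e v → Conn e v (src e) ⊎ Conn e v (tgt e)
  toEndpoint e v with avoidOrCross e (λ _ _ j≢e → j≢e) (connected T v (src e))
  ... | inj₁ v~src = inj₁ v~src
  ... | inj₂ (v-near-e , _) = v-near-e

  cut : ∀ e → ¬ Conn e (src e) (tgt e)
  cut e src~tgt = StillConnected.notTree (edge T) e (src e) toSrc (edgeCount T)
    where
    toSrc : ∀ v → Conn e v (src e)
    toSrc v = [ id , _▷ reverse src~tgt ]′ (toEndpoint e v)

  -- Connectivity in T - e is decided by the endpoint of e each vertex reaches.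
  conn? : ∀ e u v → Dec (Conn e u v)
  conn? e u v with toEndpoint e u | toEndpoint e v
  ... | inj₁ u~src | inj₁ v~src = yes (u~src ▷ reverse v~src)
  ... | inj₂ u~tgt | inj₂ v~tgt = yes (u~tgt ▷ reverse v~tgt)
  ... | inj₁ u~src | inj₂ v~tgt = no λ u~v → cut e (reverse u~src ▷ u~v ▷ v~tgt)
  ... | inj₂ u~tgt | inj₁ v~src = no λ u~v → cut e (reverse v~src ▷ reverse u~v ▷ u~tgt)

  eitherSide : ∀ {e u v} → ¬ Conn e u v → ∀ w → Conn e w u ⊎ Conn e w v
  eitherSide {e} {u} {v} u≁v w with toEndpoint e w | toEndpoint e u | toEndpoint e v
  ... | inj₁ w~src | inj₁ u~src | _ = inj₁ (w~src ▷ reverse u~src)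
  ... | inj₂ w~tgt | inj₂ u~tgt | _ = inj₁ (w~tgt ▷ reverse u~tgt)
  ... | inj₁ w~src | inj₂ _ | inj₁ v~src = inj₂ (w~src ▷ reverse v~src)
  ... | inj₂ w~tgt | inj₁ _ | inj₂ v~tgt = inj₂ (w~tgt ▷ reverse v~tgt)
  ... | inj₁ _ | inj₂ u~tgt | inj₂ v~tgt = ⊥-elim (u≁v (u~tgt ▷ reverse v~tgt))
  ... | inj₂ _ | inj₁ u~src | inj₁ v~src = ⊥-elim (u≁v (u~src ▷ reverse v~src))

  farEndpoint : ∀ e w → Σ Vertex λ b → (src e ≡ b ⊎ tgt e ≡ b) × ¬ Conn e w b
  farEndpoint e w with toEndpoint e w
  ... | inj₁ w~src = tgt e , inj₂ refl , λ w~tgt → cut e (reverse w~src ▷ w~tgt)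
  ... | inj₂ w~tgt = src e , inj₁ refl , λ w~src → cut e (reverse w~src ▷ w~tgt)

  joins-endpoint : ∀ {e v u} → Joins (edge T) e v u → src e ≡ v ⊎ tgt e ≡ v
  joins-endpoint (inj₁ eq) = inj₁ (cong proj₁ eq)
  joins-endpoint (inj₂ eq) = inj₂ (cong proj₂ eq)

  joins-cut : ∀ {e v u} → Joins (edge T) e v u → ¬ Conn e v u
  joins-cut {e} (inj₁ eq) v~u = cut e (subst₂ (Conn e) (sym (cong proj₁ eq)) (sym (cong proj₂ eq)) v~u)
  joins-cut {e} (inj₂ eq) v~u = cut e (subst₂ (Conn e) (sym (cong proj₁ eq)) (sym (cong proj₂ eq)) (reverse v~u))

  joins-conn : ∀ {e h v u} → Joins (edge T) e v u → h ≢ e → Conn h v u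
  joins-conn e-joins h≢e = joins-walk e-joins (h≢e ∘ sym)

  shrink : ∀ {e e′ a b} → e′ ≢ e → ¬ Conn e a b → (Conn e (src e′) b ⊎ Conn e (tgt e′) b) →
           ∀ {u} → Conn e u a → Conn e′ u a
  shrink {e} {e′} {a} {b} e′≢e a≁b e′-near-b u~a
    with avoidOrCross e′ {A = NotEdge e} {B = λ j → j ≢ e × j ≢ e′} (λ _ j≢e j≢e′ → j≢e , j≢e′) u~a
  ... | inj₁ avoiding = weaken (λ _ → proj₂) avoiding
  ... | inj₂ (_ , a-near-e′) = ⊥-elim (a≁b (aToSrc a-near-e′ ▷ srcToB))
    where
    Avoiding : Vertex → Vertex → Set
    Avoiding = Reach (edge T) (λ j → j ≢ e × j ≢ e′)
    aToSrc : Avoiding a (src e′) ⊎ Avoiding a (tgt e′) → Conn e a (src e′)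
    aToSrc = [ weaken (λ _ → proj₁) , (λ a~tgt → weaken (λ _ → proj₁) a~tgt ▷ against e′ e′≢e) ]′
    srcToB : Conn e (src e′) b
    srcToB = [ id , along e′ e′≢e ▷_ ]′ e′-near-b

  lastEdge : ∀ {a w} → Reach (edge T) AnyEdge a w → a ≢ w →
             Σ Edge λ g → Σ Vertex λ u → Joins (edge T) g w u × ¬ Conn g w a
  lastEdge here a≢w = ⊥-elim (a≢w refl)
  lastEdge {w = w} (fwd j _ refl rest) a≢w with tgt j Fin.≟ w
  ... | yes refl = j , src j , inj₂ refl , cut j ∘ reverse
  ... | no tgt≢w with lastEdge rest tgt≢w
  ...   | g , u , g-joins , g-sep with g Fin.≟ j
  ...     | yes refl = ⊥-elim ([ a≢w , tgt≢w ]′ (joins-endpoint g-joins))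
  ...     | no g≢j = g , u , g-joins , λ w~src → g-sep (w~src ▷ along j (g≢j ∘ sym))
  lastEdge {w = w} (bwd j _ refl rest) a≢w with src j Fin.≟ w
  ... | yes refl = j , tgt j , inj₁ refl , cut j
  ... | no src≢w with lastEdge rest src≢w
  ...   | g , u , g-joins , g-sep with g Fin.≟ j
  ...     | yes refl = ⊥-elim ([ src≢w , a≢w ]′ (joins-endpoint g-joins))
  ...     | no g≢j = g , u , g-joins , λ w~tgt → g-sep (w~tgt ▷ against j (g≢j ∘ sym))

  near : Vertex → Edge → Subset n
  near v e = subsetOf (λ x → conn? e (φ T x) v)

  inNear : ∀ {v e x} → x ∈ near v e → Conn e (φ T x) v
  inNear {v} {e} = Equivalence.to (∈-subsetOf (λ x → conn? e (φ T x) v))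

  toNear : ∀ {v e x} → Conn e (φ T x) v → x ∈ near v e
  toNear {v} {e} = Equivalence.from (∈-subsetOf (λ x → conn? e (φ T x) v))

  near-conn : ∀ {e u v} → Conn e u v → near u e ≡ near v e
  near-conn u~v = subset-ext λ x →
    mk⇔ (λ x∈ → toNear (inNear x∈ ▷ u~v)) (λ x∈ → toNear (inNear x∈ ▷ reverse u~v))

  near-sep : ∀ {e u v} → ¬ Conn e u v → near u e ≡ ∁ (near v e)
  near-sep u≁v = subset-ext λ x →
    mk⇔ (λ x∈u → x∉p⇒x∈∁p λ x∈v → u≁v (reverse (inNear x∈u) ▷ inNear x∈v))
        (λ x∈∁v → [ toNear , (λ x~v → ⊥-elim (x∈∁p⇒x∉p x∈∁v (toNear x~v))) ]′ (eitherSide u≁v (φ T _)))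

  near-shrink : ∀ {e e′ a b} → e′ ≢ e → ¬ Conn e a b → (Conn e (src e′) b ⊎ Conn e (tgt e′) b) →
                near a e ⊆ near a e′
  near-shrink e′≢e a≁b e′-near-b = toNear ∘ shrink e′≢e a≁b e′-near-b ∘ inNear

  profile : Vertex → Subset n → ℕ
  profile v B = count (λ e → near v e ≟ˢ B)

-- Profiles determine vertices and edges

LabelledSides : ∀ {n} → WeakXTree n → Set
LabelledSides T = ∀ e v → Nonempty (TreeGeometry.near T v e)

module Profiles {n : ℕ} (T : WeakXTree n) (labelled : LabelledSides T) where

  open TreeGeometry T public

  near-differ : ∀ {e u v} → ¬ Conn e u v → near u e ≢ near v e
  near-differ {e} {u} {v} u≁v same with labelled e v
  ... | x , x∈v = x∈∁p⇒x∉p (subst (x ∈_) (near-sep u≁v) (subst (x ∈_) (sym same) x∈v)) x∈v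

  separators-differ : ∀ {e e′ v w} → ¬ Conn e v w → ¬ Conn e′ v w → near w e′ ≢ near v e
  separators-differ {e} {e′} {v} {w} e-sep e′-sep same with e′ Fin.≟ e
  ... | yes refl = near-differ (e-sep ∘ reverse) same
  ... | no e′≢e with eitherSide e-sep (src e′)
  ...   | inj₁ src~v = e-sep (reverse (inNear y∈v) ▷ inNear y∈w)
    where
    -- near w e ⊆ near w e′ = near v e, so a label near w for e is near v
    y : Fin n
    y = proj₁ (labelled e w)
    y∈w : y ∈ near w e
    y∈w = proj₂ (labelled e w)
    y∈v : y ∈ near v e
    y∈v = subst (y ∈_) same (near-shrink e′≢e (e-sep ∘ reverse) (inj₁ src~v) y∈w)
  ...   | inj₂ src~w = e′-sep (reverse (inNear x∈v′) ▷ inNear x∈w′)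
    where
    -- near v e ⊆ near v e′, while near v e = near w e′
    x : Fin n
    x = proj₁ (labelled e v)
    x∈v : x ∈ near v e
    x∈v = proj₂ (labelled e v)
    x∈v′ : x ∈ near v e′
    x∈v′ = near-shrink e′≢e e-sep (inj₁ src~w) x∈v
    x∈w′ : x ∈ near w e′
    x∈w′ = subst (x ∈_) (sym same) x∈v

  -- Distinct vertices have distinct profiles: if e separates v from w,
  -- every edge with side A = near v e at w has side A at v as well, but
  -- not conversely (e itself), so A occurs more often at v than at w.
  profile-injective : ∀ {v w} → (∀ B → profile v B ≡ profile w B) → v ≡ w
  profile-injective {v} {w} same with v Fin.≟ w
  ... | yes v≡w = v≡w
  ... | no v≢w with lastEdge (connected T v w) v≢w
  ...   | e , _ , _ , e-sep = ⊥-elim (<-irrefl (sym (same A)) fewer)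
    where
    A : Subset n
    A = near v e
    sideAtV : ∀ e′ → near w e′ ≡ A → near v e′ ≡ A
    sideAtV e′ at-w with conn? e′ v w
    ... | yes v~w = trans (near-conn v~w) at-w
    ... | no v≁w = ⊥-elim (separators-differ (e-sep ∘ reverse) v≁w at-w)
    fewer : profile w A < profile v A
    fewer = count-strict (λ e′ → near w e′ ≟ˢ A) (λ e′ → near v e′ ≟ˢ A) sideAtV e (near-differ e-sep) refl

  MinimalAt : Vertex → Subset n → Set
  MinimalAt v A = 1 ≤ profile v A × (∀ D → D ⊆ A → D ≢ A → profile v D ≡ 0)

  incident⇒minimal : ∀ {e v u} → Joins (edge T) e v u → MinimalAt v (near v e)
  incident⇒minimal {e} {v} {u} e-joins =
    count-pos (λ h → near v h ≟ˢ A) e refl ,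
    λ D D⊆A D≢A → count-none (λ h → near v h ≟ˢ D) (noEdge D⊆A D≢A)
    where
    A : Subset n
    A = near v e
    noEdge : ∀ {D} → D ⊆ A → D ≢ A → ∀ h → near v h ≢ D
    noEdge D⊆A D≢A h vh≡D with h Fin.≟ e
    ... | yes refl = D≢A (sym vh≡D)
    ... | no h≢e with eitherSide (joins-cut e-joins) (src h)
    -- h beyond e as seen from v: then A ⊆ near v h = D
    ...   | inj₂ src~u = D≢A (⊆-antisym D⊆A (subst (A ⊆_) vh≡D (near-shrink h≢e (joins-cut e-joins) (inj₁ src~u))))
    -- h beyond e as seen from u: a label near u for e is then near v for h, hence in A
    ...   | inj₁ src~v = joins-cut e-joins (reverse (inNear y∈A) ▷ inNear y∈u)
      where
      y : Fin n
      y = proj₁ (labelled e u)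
      y∈u : y ∈ near u e
      y∈u = proj₂ (labelled e u)
      y∈A : y ∈ A
      y∈A = D⊆A (subst (y ∈_) (trans (near-conn (reverse (joins-conn e-joins h≢e))) vh≡D)
                        (near-shrink h≢e (joins-cut e-joins ∘ reverse) (inj₁ src~v) y∈u))

  -- Take an edge f with side A at w and the last edge g on a walk from the
  -- far endpoint of f to w: the side of g at w is contained in A, so by
  -- minimality it equals A.
  minimal⇒incident : ∀ {w A} → MinimalAt w A →
                     Σ Edge λ g → Σ Vertex λ u → Joins (edge T) g w u × near w g ≡ A
  minimal⇒incident {w} {A} (occurs , minimal) with count-witness (λ h → near w h ≟ˢ A) occurs
  ... | f , wf≡A with farEndpoint f w
  ...   | b , b-end , f-sep with lastEdge (connected T b w) (λ b≡w → f-sep (subst (Conn f w) (sym b≡w) here))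
  ...     | g , u , g-joins , g-sep = g , u , g-joins , g-side
    where
    endpointNear : Conn g (src f) b ⊎ Conn g (tgt f) b
    endpointNear = [ (λ { refl → inj₁ here }) , (λ { refl → inj₂ here }) ]′ b-end
    g-below : near w g ⊆ A
    g-below with g Fin.≟ f
    ... | yes refl = subst (near w g ⊆_) wf≡A id
    ... | no g≢f = subst (near w g ⊆_) wf≡A (near-shrink (g≢f ∘ sym) g-sep endpointNear)
    g-occurs : 1 ≤ profile w (near w g)
    g-occurs = count-pos (λ h → near w h ≟ˢ near w g) g refl
    g-side : near w g ≡ A
    g-side with near w g ≟ˢ A
    ... | yes eq = eq
    ... | no neq with subst (1 ≤_) (minimal _ g-below neq) g-occurs
    ...   | ()

  -- Crossing the edge e from v to u replaces the side near v e by its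
  -- complement and leaves all other sides unchanged.
  profile-step : ∀ {e v u} → Joins (edge T) e v u → ∀ B →
                 profile u B + [ near v e ≟ˢ B ] ≡ profile v B + [ ∁ (near v e) ≟ˢ B ]
  profile-step {e} {v} {u} e-joins B = begin
    profile u B + [ near v e ≟ˢ B ]      ≡⟨ count-swap (λ h → near u h ≟ˢ B) (λ h → near v h ≟ˢ B) e unchanged ⟩
    profile v B + [ near u e ≟ˢ B ]      ≡⟨ cong (λ C → profile v B + [ C ≟ˢ B ]) (near-sep (joins-cut e-joins ∘ reverse)) ⟩
    profile v B + [ ∁ (near v e) ≟ˢ B ]  ∎
    where
    open ≡-Reasoning
    unchanged : ∀ h → h ≢ e → near u h ≡ B ⇔ near v h ≡ B
    unchanged h h≢e = mk⇔ (trans (sym u~v)) (trans u~v)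
      where
      u~v : near u h ≡ near v h
      u~v = near-conn (reverse (joins-conn e-joins h≢e))

NontrivialSplit : ∀ {n} → Subset n → Set
NontrivialSplit A = Nonempty A × Nonempty (∁ A)

Displays : ∀ {n K} (T : WeakXTree n) → (Fin K → Subset n) → Fin (#E T) ↔ Fin K → Set
Displays T As β = ∀ e → SplitEq (splitSide T e) (As (Inverse.to β e))

module Displayed {n K : ℕ} (T : WeakXTree n) (As : Fin K → Subset n) (β : Fin (#E T) ↔ Fin K)
                 (displays : Displays T As β) where

  open TreeGeometry T

  splitOf : Edge → Subset n
  splitOf e = As (Inverse.to β e)

  srcSide : ∀ e → IsSideOf (near (src e) e) (splitOf e)
  srcSide e with displays e
  ... | inj₁ src-side = inj₁ (subset-ext λ x →
          mk⇔ (Equivalence.to (src-side x) ∘ reverse ∘ inNear) (toNear ∘ reverse ∘ Equivalence.from (src-side x)))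
  ... | inj₂ tgt-side = inj₂ (subset-ext λ x →
          mk⇔ (x∉p⇒x∈∁p ∘ Equivalence.to (tgt-side x) ∘ reverse ∘ inNear)
              (toNear ∘ reverse ∘ Equivalence.from (tgt-side x) ∘ x∈∁p⇒x∉p))

  near-displayed : ∀ e v → IsSideOf (near v e) (splitOf e)
  near-displayed e v = [ viaSrc , viaTgt ]′ (toEndpoint e v)
    where
    viaSrc : Conn e v (src e) → IsSideOf (near v e) (splitOf e)
    viaSrc v~src = subst (λ C → IsSideOf C (splitOf e)) (sym (near-conn v~src)) (srcSide e)
    viaTgt : Conn e v (tgt e) → IsSideOf (near v e) (splitOf e)
    viaTgt v~tgt = subst (λ C → IsSideOf C (splitOf e)) (sym (trans (near-conn v~tgt) (near-sep (cut e ∘ reverse))))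
                         (∁-side (srcSide e))

  labelled : (∀ i → NontrivialSplit (As i)) → LabelledSides T
  labelled nontrivial e v with near-displayed e v
  ... | inj₁ eq = subst Nonempty (sym eq) (proj₁ (nontrivial (Inverse.to β e)))
  ... | inj₂ eq = subst Nonempty (sym eq) (proj₂ (nontrivial (Inverse.to β e)))

  profile-label : ∀ x B → profile (φ T x) B ≡ count (λ i → sideOf x (As i) ≟ˢ B)
  profile-label x B = begin
    profile (φ T x) B                                 ≡⟨ count-cong _ _ (λ e → mk⇔ (trans (sym (side e))) (trans (side e))) ⟩
    count (λ e → sideOf x (splitOf e) ≟ˢ B)          ≡⟨ count-permute (λ i → sideOf x (As i) ≟ˢ B) β ⟩
    count (λ i → sideOf x (As i) ≟ˢ B)               ∎
    where
    open ≡-Reasoning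
    side : ∀ e → near (φ T x) e ≡ sideOf x (splitOf e)
    side e = sideOf-unique (near-displayed e (φ T x)) (toNear here)

-- Two trees displaying the same non-trivial splits are isomorphic

-- Vertices of T and T′ are matched when they have the same profile.  A
-- vertex matched to v can follow every edge at v to a vertex matched to
-- its other end.
module Transport {n : ℕ} (T T′ : WeakXTree n) (lab : LabelledSides T) (lab′ : LabelledSides T′) where

  module P = Profiles T lab
  module P′ = Profiles T′ lab′

  Matches : Fin (#V T) → Fin (#V T′) → Set
  Matches v w = ∀ B → P′.profile w B ≡ P.profile v B

  minimal-transfer : ∀ {v w A} → Matches v w → P.MinimalAt v A → P′.MinimalAt w A
  minimal-transfer {A = A} match (occurs , minimal) =
    subst (1 ≤_) (sym (match A)) occurs , λ D D⊆A D≢A → trans (match D) (minimal D D⊆A D≢A)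

  -- The edge at w with the same label as e leads to a match of u; the
  -- profile of its far end is computed by cancelling in profile-step.
  follow : ∀ {e v u w} → Joins (edge T) e v u → Matches v w →
           Σ (Fin (#V T′)) λ w′ → Adjacent (edge T′) w w′ × Matches u w′
  follow {e} {v} {u} {w} e-joins match
    with P′.minimal⇒incident (minimal-transfer match (P.incident⇒minimal e-joins))
  ... | g , w′ , g-joins , g-side = w′ , (g , g-joins) , λ B → +-cancelʳ-≡ _ _ _ (balance B)
    where
    A : Subset n
    A = P.near v e
    balance : ∀ B → P′.profile w′ B + [ A ≟ˢ B ] ≡ P.profile u B + [ A ≟ˢ B ]
    balance B = begin
      P′.profile w′ B + [ A ≟ˢ B ]                ≡⟨ cong (λ C → P′.profile w′ B + [ C ≟ˢ B ]) (sym g-side) ⟩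
      P′.profile w′ B + [ P′.near w g ≟ˢ B ]      ≡⟨ P′.profile-step g-joins B ⟩
      P′.profile w B + [ ∁ (P′.near w g) ≟ˢ B ]   ≡⟨ cong₂ (λ c C → c + [ ∁ C ≟ˢ B ]) (match B) g-side ⟩
      P.profile v B + [ ∁ A ≟ˢ B ]                ≡⟨ sym (P.profile-step e-joins B) ⟩
      P.profile u B + [ A ≟ˢ B ]                  ∎
      where open ≡-Reasoning

  transport : ∀ {a v w} → Reach (edge T) AnyEdge a v → Matches a w → Σ (Fin (#V T′)) (Matches v)
  transport here match = _ , match
  transport (fwd j _ refl rest) match = transport rest (proj₂ (proj₂ (follow (inj₁ refl) match)))
  transport (bwd j _ refl rest) match = transport rest (proj₂ (proj₂ (follow (inj₂ refl) match)))


-- The isomorphism ψ sends v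
-- to the vertex of T′ with the same profile, found by copying a walk from
-- a labelled vertex; ψ⁻¹ is built symmetrically.
module Uniqueness {n K : ℕ} (x₀ : Fin n) (As : Fin K → Subset n) (nontrivial : ∀ i → NontrivialSplit (As i))
                  (T T′ : WeakXTree n) (β : Fin (#E T) ↔ Fin K) (β′ : Fin (#E T′) ↔ Fin K)
                  (displays : Displays T As β) (displays′ : Displays T′ As β′) where

  module D = Displayed T As β displays
  module D′ = Displayed T′ As β′ displays′
  module F = Transport T T′ (D.labelled nontrivial) (D′.labelled nontrivial)
  module G = Transport T′ T (D′.labelled nontrivial) (D.labelled nontrivial)
  module P = F.P
  module P′ = F.P′

  labels-match : ∀ x → F.Matches (φ T x) (φ T′ x)
  labels-match x B = trans (D′.profile-label x B) (sym (D.profile-label x B))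

  ψ : Fin (#V T) → Fin (#V T′)
  ψ v = proj₁ (F.transport (connected T (φ T x₀) v) (labels-match x₀))

  ψ-match : ∀ v → F.Matches v (ψ v)
  ψ-match v = proj₂ (F.transport (connected T (φ T x₀) v) (labels-match x₀))

  ψ⁻¹ : Fin (#V T′) → Fin (#V T)
  ψ⁻¹ w = proj₁ (G.transport (connected T′ (φ T′ x₀) w) (sym ∘ labels-match x₀))

  ψ⁻¹-match : ∀ w → G.Matches w (ψ⁻¹ w)
  ψ⁻¹-match w = proj₂ (G.transport (connected T′ (φ T′ x₀) w) (sym ∘ labels-match x₀))

  -- ψ and ψ⁻¹ are mutually inverse since profiles determine vertices.
  ψ-inverseˡ : ∀ w → ψ (ψ⁻¹ w) ≡ w
  ψ-inverseˡ w = P′.profile-injective λ B → trans (ψ-match (ψ⁻¹ w) B) (ψ⁻¹-match w B)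

  ψ-inverseʳ : ∀ v → ψ⁻¹ (ψ v) ≡ v
  ψ-inverseʳ v = P.profile-injective λ B → trans (ψ⁻¹-match (ψ v) B) (ψ-match v B)

  adjacent-forth : ∀ u v → Adjacent (edge T) u v → Adjacent (edge T′) (ψ u) (ψ v)
  adjacent-forth u v (e , e-joins) =
    let (w , adj , w-match) = F.follow e-joins (ψ-match u)
    in subst (Adjacent (edge T′) (ψ u)) (P′.profile-injective λ B → trans (w-match B) (sym (ψ-match v B))) adj

  adjacent-back : ∀ u v → Adjacent (edge T′) (ψ u) (ψ v) → Adjacent (edge T) u v
  adjacent-back u v (g , g-joins) =
    let (z , adj , z-match) = G.follow g-joins (ψ⁻¹-match (ψ u))
    in subst₂ (Adjacent (edge T)) (ψ-inverseʳ u)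
              (trans (P.profile-injective λ B → trans (z-match B) (sym (ψ⁻¹-match (ψ v) B))) (ψ-inverseʳ v)) adj

  labels-preserved : ∀ x → φ T′ x ≡ ψ (φ T x)
  labels-preserved x = P′.profile-injective λ B → trans (labels-match x B) (sym (ψ-match (φ T x) B))

  isomorphism : Isomorphic T T′
  isomorphism = mk↔ₛ′ ψ ψ⁻¹ ψ-inverseˡ ψ-inverseʳ ,
                (λ u v → mk⇔ (adjacent-forth u v) (adjacent-back u v)) ,
                labels-preserved

splitsDetermineTree : ∀ {n K} (x₀ : Fin n) (As : Fin K → Subset n) → (∀ i → NontrivialSplit (As i)) →
                      (T T′ : WeakXTree n) (β : Fin (#E T) ↔ Fin K) (β′ : Fin (#E T′) ↔ Fin K) →
                      Displays T As β → Displays T′ As β′ → Isomorphic T T′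
splitsDetermineTree x₀ As nontrivial T T′ β β′ displays displays′ =
  Uniqueness.isomorphism x₀ As nontrivial T T′ β β′ displays displays′

nested⇒compatible : ∀ {n} {A B : Subset n} → Nested A B → CompatibleSplits A B
nested⇒compatible (inj₁ A∩B-empty) = inj₁ A∩B-empty
nested⇒compatible {A = A} {B} (inj₂ (inj₁ A∩B≡A)) = inj₂ (inj₁ λ (x , x∈A-B) →
  let (x∈A , x∈∁B) = x∈p∩q⁻ A (∁ B) x∈A-B
  in x∈∁p⇒x∉p x∈∁B (proj₂ (x∈p∩q⁻ A B (subst (x ∈_) (sym A∩B≡A) x∈A))))
nested⇒compatible {A = A} {B} (inj₂ (inj₂ A∩B≡B)) = inj₂ (inj₂ (inj₁ λ (x , x∈B-A) →
  let (x∈∁A , x∈B) = x∈p∩q⁻ (∁ A) B x∈B-A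
  in x∈∁p⇒x∉p x∈∁A (proj₁ (x∈p∩q⁻ A B (subst (x ∈_) (sym A∩B≡B) x∈B)))))

disjoint⇒⊆∁ˡ : ∀ {n} {A C : Subset n} → Disjoint A C → A ⊆ ∁ C
disjoint⇒⊆∁ˡ A#C x∈A = x∉p⇒x∈∁p λ x∈C → A#C (_ , x∈p∩q⁺ (x∈A , x∈C))

disjoint⇒⊆∁ʳ : ∀ {n} {A C : Subset n} → Disjoint A C → C ⊆ ∁ A
disjoint⇒⊆∁ʳ A#C x∈C = x∉p⇒x∈∁p λ x∈A → A#C (_ , x∈p∩q⁺ (x∈A , x∈C))

-- In a list of at least two pairwise disjoint non-empty sets, each set
-- gives a non-trivial split: another set of the list lies outside it.
disjoint⇒nontrivial : ∀ {n} (Cs : List (Subset n)) → 2 ≤ length Cs → All Nonempty Cs →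
                      AllPairs Disjoint Cs → All NontrivialSplit Cs
disjoint⇒nontrivial [] () _ _
disjoint⇒nontrivial (_ ∷ []) (s≤s ()) _ _
disjoint⇒nontrivial (A ∷ B ∷ Cs) _ (A≠∅ ∷ B≠∅ ∷ Cs≠∅) ((A#B ∷ A#Cs) ∷ _) =
  (A≠∅ , map₂ (disjoint⇒⊆∁ʳ A#B) B≠∅) ∷
  All.zipWith (λ (A#C , C≠∅) → C≠∅ , map₂ (disjoint⇒⊆∁ˡ A#C) A≠∅) (A#B ∷ A#Cs , B≠∅ ∷ Cs≠∅)

allParts-nontrivial : ∀ {n} (Π : PartitionSystem n) → All NontrivialSplit (allParts Π)
allParts-nontrivial [] = []
allParts-nontrivial (π ∷ Π) =
  ++⁺ (disjoint⇒nontrivial (parts π) (atLeast2 π) (nonempty π) (disjoint π)) (allParts-nontrivial Π)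

-- The cluster C_e is the side of σ_e away from the root, so a rooted tree
-- whose clusters are the parts of Π displays the parts of Π.
module Clusters {n : ℕ} (Tρ : RootedWeakXTree n) where

  open TreeGeometry (unrooted Tρ)

  ρ : Vertex
  ρ = root Tρ

  label : Fin n → Vertex
  label = φ (unrooted Tρ)

  display : (Π : PartitionSystem n) (hc : HasClusters Tρ Π) →
            Displays (unrooted Tρ) (List.lookup (allParts Π)) (proj₁ hc)
  display Π (β , clusters) e with conn? e (src e) ρ
  -- ρ is on the source side of e, which is therefore the complement of C_e.
  ... | yes src~ρ = inj₂ λ x → mk⇔ (outsideCluster x) (srcReaches x)
    where
    C : Subset n
    C = List.lookup (allParts Π) (Inverse.to β e)
    outsideCluster : ∀ x → Conn e (src e) (label x) → x ∉ C
    outsideCluster x src~x x∈C = Equivalence.from (clusters e x) x∈C (reverse src~x ▷ src~ρ)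
    srcReaches : ∀ x → x ∉ C → Conn e (src e) (label x)
    srcReaches x x∉C with conn? e (label x) ρ
    ... | yes x~ρ = src~ρ ▷ reverse x~ρ
    ... | no x≁ρ = ⊥-elim (x∉C (Equivalence.to (clusters e x) x≁ρ))
  -- ρ is on the target side of e, and the source side is C_e.
  ... | no src≁ρ = inj₁ λ x → mk⇔ (insideCluster x) (srcReaches x)
    where
    C : Subset n
    C = List.lookup (allParts Π) (Inverse.to β e)
    insideCluster : ∀ x → Conn e (src e) (label x) → x ∈ C
    insideCluster x src~x = Equivalence.to (clusters e x) λ x~ρ → src≁ρ (src~x ▷ x~ρ)
    srcReaches : ∀ x → x ∈ C → Conn e (src e) (label x)
    srcReaches x x∈C = [ reverse , (λ x~ρ → ⊥-elim (Equivalence.from (clusters e x) x∈C x~ρ)) ]′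
                         (eitherSide src≁ρ (label x))

proposition7p1 : (n : ℕ) → 2 ≤ n → (Π : PartitionSystem n) → Hierarchical Π →
    Compatible Π ×
    ((T : WeakXTree n) → HasSplits T Π →
     (Tρ : RootedWeakXTree n) → HasClusters Tρ Π →
     Isomorphic T (unrooted Tρ))
proposition7p1 zero () _ _
proposition7p1 (suc n) _ Π hierarchical = AllPairs.map nested⇒compatible hierarchical , isomorphic
  where
  nontrivial : ∀ i → NontrivialSplit (List.lookup (allParts Π) i)
  nontrivial i = All.lookup (allParts-nontrivial Π) (∈-lookup i)
  isomorphic : (T : WeakXTree (suc n)) → HasSplits T Π →
               (Tρ : RootedWeakXTree (suc n)) → HasClusters Tρ Π → Isomorphic T (unrooted Tρ)
  isomorphic T (β , displays) Tρ hc =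
    splitsDetermineTree zero (List.lookup (allParts Π)) nontrivial T (unrooted Tρ) β (proj₁ hc)
                        displays (Clusters.display Tρ Π hc)
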